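{- Let $\mathbb H_2$ be the tree with vertex set $\{1,\dots,7\}$ and edge set $\{12,23,24,46,56,67\}$. For any bag-minimal $\mathbb H_2$-model $\mathcal X=\{X_1,\dots,X_7\}$ in a graph $G$: (i) $|X_1|=|X_3|=|X_5|=|X_7|=1$; (ii) $G[X_4]$ is a path from a unique $X_2$-attachment vertex $x$ in $X_4$ to a unique $X_6$-attachment vertex $y$ in $X_4$.
   Context: All graphs are finite and simple. For a graph $H$, an $H$-model in $G$ is a family $\{X_y: y\in V(H)\}$ of nonempty, pairwise disjoint vertex subsets of $G$, each inducing a connected subgraph, such that for distinct $y,z$, $X_y$ and $X_z$ are joined by some edge of $G$ if and only if $yz\in E(H)$. $\mathcal X'$ is contained in $\mathcal X$ if $X'_y\subseteq X_y$ for all $y$; $\mathcal X'$ is smaller than $\mathcal X$ if $\sum_y|X'_y|<\sum_y|X_y|$; $\mathcal X$ is bag-minimal if no smaller $H$-model is contained in it. For $yz\in E(H)$, an $X_z$-attachment vertex in $X_y$ is a vertex of $X_y$ with a neighbour in $X_z$. -}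

module Defs where

open import Data.Nat using (ℕ; zero; suc; _+_; _<_)
open import Data.Fin using (Fin; zero; suc; toℕ; fromℕ)
open import Data.Fin.Subset using (Subset; _∈_; _⊆_; ∣_∣)
open import Data.Vec.Functional using (foldr)
open import Data.Product using (Σ; ∃; _×_; _,_)
open import Data.Sum using (_⊎_)
open import Data.Empty using (⊥)
open import Relation.Nullary using (¬_)
open import Relation.Binary.PropositionalEquality using (_≡_; _≢_)
open import Function.Bundles using (_⇔_)
open import Function.Definitions using (Injective)

record Graph : Set₁ where
  field
    n      : ℕ
    Adj    : Fin n → Fin n → Set
    sym    : ∀ {u v} → Adj u v → Adj v u
    irrefl : ∀ {u} → ¬ Adj u u

open Graph public

module _ (G : Graph) where

  data WalkIn (S : Subset (n G)) : Fin (n G) → Fin (n G) → Set where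
    here : ∀ {u} → u ∈ S → WalkIn S u u
    step : ∀ {u w v} → u ∈ S → Adj G u w → WalkIn S w v → WalkIn S u v

  ConnectedNonempty : Subset (n G) → Set
  ConnectedNonempty S = (∃ λ v → v ∈ S) × (∀ u v → u ∈ S → v ∈ S → WalkIn S u v)

  Joined : Subset (n G) → Subset (n G) → Set
  Joined S T = ∃ λ u → ∃ λ v → u ∈ S × v ∈ T × Adj G u v

  Attachment : Subset (n G) → Subset (n G) → Fin (n G) → Set
  Attachment S T x = x ∈ T × (∃ λ v → v ∈ S × Adj G x v)

  InducedPathFromTo : Subset (n G) → Fin (n G) → Fin (n G) → Set
  InducedPathFromTo S x y =
    Σ ℕ λ k → Σ (Fin (suc k) → Fin (n G)) λ p →
      Injective _≡_ _≡_ p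
      × (∀ v → v ∈ S ⇔ (∃ λ i → p i ≡ v))
      × p zero ≡ x
      × p (fromℕ k) ≡ y
      × (∀ i j → Adj G (p i) (p j) ⇔ (toℕ i ≡ suc (toℕ j) ⊎ toℕ j ≡ suc (toℕ i)))

record IsModel (H G : Graph) (X : Fin (n H) → Subset (n G)) : Set where
  field
    connected : ∀ y → ConnectedNonempty G (X y)
    disjoint  : ∀ y z → y ≢ z → ∀ v → v ∈ X y → v ∈ X z → ⊥
    edges     : ∀ y z → y ≢ z → (Joined G (X y) (X z) ⇔ Adj H y z)

totalSize : ∀ {m k} → (Fin m → Subset k) → ℕ
totalSize X = foldr _+_ 0 (λ y → ∣ X y ∣)

ContainedIn : ∀ {m k} → (Fin m → Subset k) → (Fin m → Subset k) → Set
ContainedIn X' X = ∀ y → X' y ⊆ X y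

BagMinimal : (H G : Graph) → (Fin (n H) → Subset (n G)) → Set
BagMinimal H G X =
  IsModel H G X ×
  (∀ X' → IsModel H G X' → ContainedIn X' X → ¬ (totalSize X' < totalSize X))

-- The tree ℍ₂: vertices 1..7 (as Fin 7, vertex i is index i-1),
-- edges 12, 23, 24, 46, 56, 67.
v1 v2 v3 v4 v5 v6 v7 : Fin 7
v1 = zero
v2 = suc zero
v3 = suc (suc zero)
v4 = suc (suc (suc zero))
v5 = suc (suc (suc (suc zero)))
v6 = suc (suc (suc (suc (suc zero))))
v7 = suc (suc (suc (suc (suc (suc zero)))))

data H2Edge : Fin 7 → Fin 7 → Set where
  e12 : H2Edge v1 v2
  e23 : H2Edge v2 v3
  e24 : H2Edge v2 v4
  e46 : H2Edge v4 v6
  e56 : H2Edge v5 v6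
  e67 : H2Edge v6 v7

H2Adj : Fin 7 → Fin 7 → Set
H2Adj y z = H2Edge y z ⊎ H2Edge z y

private
  H2sym : ∀ {u v} → H2Adj u v → H2Adj v u
  H2sym (Data.Sum.inj₁ e) = Data.Sum.inj₂ e
  H2sym (Data.Sum.inj₂ e) = Data.Sum.inj₁ e

  noLoop : ∀ {u} → ¬ H2Edge u u
  noLoop ()

  H2irrefl : ∀ {u} → ¬ H2Adj u u
  H2irrefl (Data.Sum.inj₁ e) = noLoop e
  H2irrefl (Data.Sum.inj₂ e) = noLoop e

ℍ₂ : Graph
ℍ₂ = record { n = 7 ; Adj = H2Adj ; sym = H2sym ; irrefl = H2irrefl }

{-# OPTIONS --safe #-}
-- Bag-minimality yields a covering principle: if S ⊆ X_y induces a connected subgraph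
-- and still touches every bag X_z with yz ∈ E(H), then S = X_y, since otherwise
-- replacing X_y by S gives a smaller model contained in X. For a leaf y with neighbour
-- w, a single X_w-attachment vertex is such an S. For the vertex 4, whose neighbours are
-- 2 and 6, the vertex set of any walk in X_4 from an X_2- to an X_6-attachment is such
-- an S. Shorten such a walk to a path P. Every walk of this kind obtained from P (the
-- part after another X_2-attachment, the part before another X_6-attachment, or P
-- short-cut along a chord) must still visit all of X_4; as P repeats no vertex, this
-- forces both attachments to be unique and P to be induced.
module Submission where

open import Defs
open import Data.Nat using (ℕ)
open import Data.Fin using (Fin)
open import Data.Fin.Subset using (Subset; ∣_∣)
open import Data.Product using (Σ; _×_)
open import Relation.Binary.PropositionalEquality using (_≡_)

open import Data.Nat using (zero; suc; _+_; _≤_; _<_; z≤n; s≤s)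
open import Data.Nat.Properties
  using (+-mono-≤; +-mono-<-≤; +-mono-≤-<; suc-injective; <-cmp; m≤n⇒m<n∨m≡n)
open import Data.Fin as Fin using (zero; suc; toℕ; fromℕ)
open import Data.Fin.Properties using (toℕ-injective)
open import Data.Fin.Subset using (_⊆_; ⁅_⁆; _∪_) renaming (⊥ to ∅; _∈_ to _∈ₛ_)
open import Data.Fin.Subset.Properties
  using (_∈?_; ⊆-antisym; p⊆q⇒∣p∣≤∣q∣; p⊂q⇒∣p∣<∣q∣; x∈⁅x⁆; x∈⁅y⁆⇒x≡y; x∈p∪q⁺; x∈p∪q⁻; ∉⊥;
         ∣⁅x⁆∣≡1)
open import Data.Vec.Functional using (foldr; updateAt)
open import Data.Vec.Functional.Properties using (updateAt-updates; updateAt-minimal)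
open import Data.List using (List; []; _∷_; _++_; _∷ʳ_; length; lookup)
open import Data.List.Relation.Unary.Any as Any using (here; there)
open import Data.List.Relation.Unary.Any.Properties using (lookup-index; singleton⁻)
open import Data.List.Relation.Unary.All as All using ([]; _∷_)
open import Data.List.Relation.Unary.All.Properties using (¬Any⇒All¬)
open import Data.List.Relation.Unary.AllPairs as AllPairs using ([]; _∷_)
open import Data.List.Relation.Unary.Unique.Propositional using (Unique)
open import Data.List.Relation.Unary.Unique.Propositional.Properties using (Unique[x∷xs]⇒x∉xs)
open import Data.List.Membership.Propositional using (_∈_; _∉_)
open import Data.List.Membership.Propositional.Properties using (∈-++⁺ʳ; ∈-++⁻; ∈-∃++; ∈-lookup)
open import Data.Product using (∃; ∃₂; _,_; proj₁; proj₂; map₁)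
open import Data.Sum using (_⊎_; inj₁; inj₂)
open import Data.Empty using (⊥-elim)
open import Relation.Nullary using (¬_; yes; no)
open import Relation.Binary.PropositionalEquality
  using (_≢_; refl; cong; trans; subst) renaming (sym to ≡-sym)
open import Relation.Binary.Definitions using (tri<; tri≈; tri>)
open import Function using (_∘_; const)
open import Function.Bundles using (mk⇔; Equivalence)

foldr-+-mono-≤ : ∀ {m} {f g : Fin m → ℕ} → (∀ i → f i ≤ g i) → foldr _+_ 0 f ≤ foldr _+_ 0 g
foldr-+-mono-≤ {zero}  f≤g = z≤n
foldr-+-mono-≤ {suc m} f≤g = +-mono-≤ (f≤g zero) (foldr-+-mono-≤ (f≤g ∘ suc))

foldr-+-mono-< : ∀ {m} {f g : Fin m → ℕ} → (∀ i → f i ≤ g i) →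
                 ∀ i → f i < g i → foldr _+_ 0 f < foldr _+_ 0 g
foldr-+-mono-< f≤g zero    fi<gi = +-mono-<-≤ fi<gi (foldr-+-mono-≤ (f≤g ∘ suc))
foldr-+-mono-< f≤g (suc i) fi<gi = +-mono-≤-< (f≤g zero) (foldr-+-mono-< (f≤g ∘ suc) i fi<gi)

updateAt-const-view : ∀ {m} {A : Set} (xs : Fin m → A) i (a : A) j →
  (j ≡ i × updateAt xs i (const a) j ≡ a) ⊎ (j ≢ i × updateAt xs i (const a) j ≡ xs j)
updateAt-const-view xs i a j with j Fin.≟ i
... | yes refl = inj₁ (refl , updateAt-updates i xs)
... | no  j≢i  = inj₂ (j≢i , updateAt-minimal j i xs j≢i)

module _ {A : Set} where

  unique-++⁻ʳ : ∀ (xs : List A) {ys} → Unique (xs ++ ys) → Unique ys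
  unique-++⁻ʳ []       u       = u
  unique-++⁻ʳ (_ ∷ xs) (_ ∷ u) = unique-++⁻ʳ xs u

  unique-++-disjoint : ∀ (xs : List A) {ys v} → Unique (xs ++ ys) → v ∈ xs → v ∉ ys
  unique-++-disjoint (_ ∷ xs) (x∉ ∷ _) (here refl) v∈ys = All.lookup x∉ (∈-++⁺ʳ xs v∈ys) refl
  unique-++-disjoint (_ ∷ xs) (_ ∷ u)  (there v∈xs) = unique-++-disjoint xs u v∈xs

  unique-++-∷-meet : ∀ (xs : List A) {z ys v} → Unique (xs ++ z ∷ ys) →
                     v ∈ xs ∷ʳ z → v ∈ z ∷ ys → v ≡ z
  unique-++-∷-meet xs u v∈xs∷ʳz v∈z∷ys with ∈-++⁻ xs v∈xs∷ʳz
  ... | inj₁ v∈xs        = ⊥-elim (unique-++-disjoint xs u v∈xs v∈z∷ys)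
  ... | inj₂ (here v≡z) = v≡z

  unique-bypass : ∀ (xs : List A) {a m ys b zs} → Unique (xs ++ a ∷ m ∷ ys ++ b ∷ zs) →
                  m ∉ xs ++ a ∷ b ∷ zs
  unique-bypass xs u m∈ with ∈-++⁻ xs m∈
  ... | inj₁ m∈xs          = unique-++-disjoint xs u m∈xs (there (here refl))
  ... | inj₂ (here m≡a)    = Unique[x∷xs]⇒x∉xs (unique-++⁻ʳ xs u) (here (≡-sym m≡a))
  ... | inj₂ (there m∈bzs) =
    Unique[x∷xs]⇒x∉xs (AllPairs.tail (unique-++⁻ʳ xs u)) (∈-++⁺ʳ _ m∈bzs)

  unique-lookup-injective : ∀ {xs : List A} → Unique xs →
                            ∀ {i j} → lookup xs i ≡ lookup xs j → i ≡ j
  unique-lookup-injective {_ ∷ _} _        {zero}  {zero}  _  = refl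
  unique-lookup-injective {_ ∷ _} (x∉ ∷ _) {zero}  {suc j} eq = ⊥-elim (All.lookup x∉ (∈-lookup j) eq)
  unique-lookup-injective {_ ∷ _} (x∉ ∷ _) {suc i} {zero}  eq =
    ⊥-elim (All.lookup x∉ (∈-lookup i) (≡-sym eq))
  unique-lookup-injective {_ ∷ _} (_ ∷ u)  {suc i} {suc j} eq = cong suc (unique-lookup-injective u eq)

  lookup-split : ∀ (xs : List A) (i j : Fin (length xs)) → suc (toℕ i) < toℕ j →
                 ∃₂ λ ys m → ∃₂ λ zs ws → xs ≡ ys ++ lookup xs i ∷ m ∷ zs ++ lookup xs j ∷ ws
  lookup-split (x ∷ xs)     (suc i) (suc j)       (s≤s i+1<j) with lookup-split xs i j i+1<j
  ... | ys , m , zs , ws , eq = x ∷ ys , m , zs , ws , cong (x ∷_) eq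
  lookup-split (x ∷ m ∷ xs) zero    (suc (suc j)) _ with ∈-∃++ (∈-lookup {xs = xs} j)
  ... | zs , ws , eq = [] , m , zs , ws , cong (λ t → x ∷ m ∷ t) eq
  lookup-split (x ∷ m ∷ xs) zero    (suc zero)    (s≤s ())

adjacent⇒distinct : ∀ G {u v} → Adj G u v → u ≢ v
adjacent⇒distinct G uv refl = irrefl G uv

module Walks (G : Graph) where

  open import Data.List.Membership.DecPropositional (Fin._≟_ {n G}) using () renaming (_∈?_ to _∈ₗ?_)

  V : Set
  V = Fin (n G)

  fromList : List V → Subset (n G)
  fromList []       = ∅
  fromList (v ∷ vs) = ⁅ v ⁆ ∪ fromList vs

  ∈-fromList⁺ : ∀ {v} vs → v ∈ vs → v ∈ₛ fromList vs
  ∈-fromList⁺ (v ∷ _)  (here refl)  = x∈p∪q⁺ (inj₁ (x∈⁅x⁆ v))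
  ∈-fromList⁺ (_ ∷ vs) (there v∈vs) = x∈p∪q⁺ (inj₂ (∈-fromList⁺ vs v∈vs))

  ∈-fromList⁻ : ∀ {v} vs → v ∈ₛ fromList vs → v ∈ vs
  ∈-fromList⁻ []       v∈ = ⊥-elim (∉⊥ v∈)
  ∈-fromList⁻ (w ∷ vs) v∈ with x∈p∪q⁻ ⁅ w ⁆ (fromList vs) v∈
  ... | inj₁ v∈⁅w⁆ = here (x∈⁅y⁆⇒x≡y w v∈⁅w⁆)
  ... | inj₂ v∈vs  = there (∈-fromList⁻ vs v∈vs)

  joined-⊆ : ∀ {A B C D} → A ⊆ C → B ⊆ D → Joined G A B → Joined G C D
  joined-⊆ A⊆C B⊆D (u , v , u∈A , v∈B , uv) = u , v , A⊆C u∈A , B⊆D v∈B , uv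

  joined-sym : ∀ {A B} → Joined G A B → Joined G B A
  joined-sym (u , v , u∈A , v∈B , uv) = v , u , v∈B , u∈A , sym G uv

  joined⇒attachment : ∀ {A B} → Joined G A B → ∃ (Attachment G B A)
  joined⇒attachment (u , v , u∈A , v∈B , uv) = u , u∈A , v , v∈B , uv

  walk-snoc : ∀ {S u w v} → WalkIn G S u w → Adj G w v → v ∈ₛ S → WalkIn G S u v
  walk-snoc (here u∈S)       wv v∈S = step u∈S wv (here v∈S)
  walk-snoc (step u∈S uw′ W) wv v∈S = step u∈S uw′ (walk-snoc W wv v∈S)

  -- A walk inside S from x to y; its vertex sequence is x ∷ xs.
  data ChainIn (S : Subset (n G)) : V → List V → V → Set where
    stop : ∀ {x} → x ∈ₛ S → ChainIn S x [] x
    step : ∀ {x w ws y} → x ∈ₛ S → Adj G x w → ChainIn S w ws y → ChainIn S x (w ∷ ws) y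

  module _ {S : Subset (n G)} where

    chain-⊆ : ∀ {x xs y v} → ChainIn S x xs y → v ∈ x ∷ xs → v ∈ₛ S
    chain-⊆ (stop x∈S)     (here refl) = x∈S
    chain-⊆ (step x∈S _ _) (here refl) = x∈S
    chain-⊆ (step _ _ c)   (there v∈)  = chain-⊆ c v∈

    chain-last∈ : ∀ {x xs y} → ChainIn S x xs y → y ∈ x ∷ xs
    chain-last∈ (stop _)     = here refl
    chain-last∈ (step _ _ c) = there (chain-last∈ c)

    chain-split : ∀ xs {x z ys y} → ChainIn S x (xs ++ z ∷ ys) y →
                  ChainIn S x (xs ∷ʳ z) z × ChainIn S z ys y
    chain-split []       (step x∈S xz c) = step x∈S xz (stop (chain-⊆ c (here refl))) , c
    chain-split (_ ∷ xs) (step x∈S xw c) = map₁ (step x∈S xw) (chain-split xs c)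

    chain-++ : ∀ xs {x a zs y} → ChainIn S x (xs ∷ʳ a) a → ChainIn S a zs y →
               ChainIn S x (xs ++ a ∷ zs) y
    chain-++ []       (step x∈S xa (stop _)) c = step x∈S xa c
    chain-++ (_ ∷ xs) (step x∈S xw c′)      c = step x∈S xw (chain-++ xs c′ c)

    chain-skip : ∀ ys {a m b zs y} → ChainIn S a (m ∷ ys ++ b ∷ zs) y → Adj G a b →
                 ChainIn S a (b ∷ zs) y
    chain-skip ys c ab = step (chain-⊆ c (here refl)) ab (proj₂ (chain-split (_ ∷ ys) c))

    chain-bypass : ∀ xs {x vs y a m ys b zs} → ChainIn S x vs y →
                   x ∷ vs ≡ xs ++ a ∷ m ∷ ys ++ b ∷ zs → Adj G a b →
                   ∃ λ ws → ChainIn S x ws y × x ∷ ws ≡ xs ++ a ∷ b ∷ zs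
    chain-bypass []       c refl ab = _ , chain-skip _ c ab , refl
    chain-bypass (_ ∷ xs) c refl ab =
      let pre , post = chain-split xs c in _ , chain-++ xs pre (chain-skip _ post ab) , refl

    chain-lookup-adj : ∀ {x xs y} → ChainIn S x xs y →
                       ∀ i j → toℕ j ≡ suc (toℕ i) →
                       Adj G (lookup (x ∷ xs) i) (lookup (x ∷ xs) j)
    chain-lookup-adj (step _ xw _) zero    (suc zero) refl = xw
    chain-lookup-adj (step _ _ c)  (suc i) (suc j)    eq   = chain-lookup-adj c i j (suc-injective eq)

    chain-lookup-last : ∀ {x xs y} → ChainIn S x xs y → lookup (x ∷ xs) (fromℕ (length xs)) ≡ y
    chain-lookup-last (stop _)     = refl
    chain-lookup-last (step _ _ c) = chain-lookup-last c

    chain-walk : ∀ {T x xs y u v} → ChainIn S x xs y → (∀ {w} → w ∈ x ∷ xs → w ∈ₛ T) →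
                 u ∈ x ∷ xs → v ∈ x ∷ xs → WalkIn G T u v
    chain-walk (stop _)      ⊆T (here refl) (here refl) = here (⊆T (here refl))
    chain-walk (step _ _ _)  ⊆T (here refl) (here refl) = here (⊆T (here refl))
    chain-walk (step _ xw c) ⊆T (here refl) (there v∈)  =
      step (⊆T (here refl)) xw (chain-walk c (⊆T ∘ there) (here refl) v∈)
    chain-walk (step _ xw c) ⊆T (there u∈)  (here refl) =
      walk-snoc (chain-walk c (⊆T ∘ there) u∈ (here refl)) (sym G xw) (⊆T (here refl))
    chain-walk (step _ _ c)  ⊆T (there u∈)  (there v∈)  = chain-walk c (⊆T ∘ there) u∈ v∈

    chain-connected : ∀ {x xs y} → ChainIn S x xs y → ConnectedNonempty G (fromList (x ∷ xs))
    chain-connected {x} {xs} c = (x , ∈-fromList⁺ (x ∷ xs) (here refl)) , λ u v u∈ v∈ →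
      chain-walk c (∈-fromList⁺ (x ∷ xs)) (∈-fromList⁻ (x ∷ xs) u∈)
                                          (∈-fromList⁻ (x ∷ xs) v∈)

  record PathIn (S : Subset (n G)) (x y : V) : Set where
    constructor path
    field
      rest   : List V
      chain  : ChainIn S x rest y
      unique : Unique (x ∷ rest)

  open PathIn public

  walk⇒path : ∀ {S u v} → WalkIn G S u v → PathIn S u v
  walk⇒path (here u∈S) = path [] (stop u∈S) ([] ∷ [])
  walk⇒path {u = u} (step u∈S uw W) with walk⇒path W
  ... | path rest c uniq with u ∈ₗ? _ ∷ rest
  ...   | no  u∉             = path (_ ∷ rest) (step u∈S uw c) (¬Any⇒All¬ _ u∉ ∷ uniq)
  ...   | yes (here refl)    = path rest c uniq
  ...   | yes (there u∈rest) with ∈-∃++ u∈rest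
  ...     | xs , ys , refl   = path ys (proj₂ (chain-split xs c)) (unique-++⁻ʳ (_ ∷ xs) uniq)

  Chordless : ∀ {S x y} → PathIn S x y → Set
  Chordless {x = x} P =
    ∀ xs {a m ys b zs} → x ∷ rest P ≡ xs ++ a ∷ m ∷ ys ++ b ∷ zs → ¬ Adj G a b

  chordless-path⇒induced : ∀ {S x y} (P : PathIn S x y) →
                           (∀ {v} → v ∈ₛ S → v ∈ x ∷ rest P) → Chordless P →
                           InducedPathFromTo G S x y
  chordless-path⇒induced {S} {x} {y} (path rest c uniq) covers chordless =
    length rest , p , unique-lookup-injective uniq , (λ v → mk⇔ (enumerated v) (enumerated⁻ v)) ,
    refl , chain-lookup-last c , λ i j → mk⇔ (adjacent⇒consecutive i j) (consecutive⇒adjacent i j)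
    where
    p = lookup (x ∷ rest)

    enumerated : ∀ v → v ∈ₛ S → ∃ λ i → p i ≡ v
    enumerated v v∈S = let v∈ = covers v∈S in Any.index v∈ , ≡-sym (lookup-index v∈)

    enumerated⁻ : ∀ v → (∃ λ i → p i ≡ v) → v ∈ₛ S
    enumerated⁻ _ (i , refl) = chain-⊆ c (∈-lookup i)

    consecutive⇒adjacent : ∀ i j → toℕ i ≡ suc (toℕ j) ⊎ toℕ j ≡ suc (toℕ i) →
                           Adj G (p i) (p j)
    consecutive⇒adjacent i j (inj₁ i≡j+1) = sym G (chain-lookup-adj c j i i≡j+1)
    consecutive⇒adjacent i j (inj₂ j≡i+1) = chain-lookup-adj c i j j≡i+1

    adjacent-<⇒successor : ∀ i j → toℕ i < toℕ j → Adj G (p i) (p j) → toℕ j ≡ suc (toℕ i)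
    adjacent-<⇒successor i j i<j pipj with m≤n⇒m<n∨m≡n i<j
    ... | inj₂ i+1≡j = ≡-sym i+1≡j
    ... | inj₁ i+1<j with lookup-split (x ∷ rest) i j i+1<j
    ...   | xs , _ , _ , _ , eq = ⊥-elim (chordless xs eq pipj)

    adjacent⇒consecutive : ∀ i j → Adj G (p i) (p j) →
                           toℕ i ≡ suc (toℕ j) ⊎ toℕ j ≡ suc (toℕ i)
    adjacent⇒consecutive i j pipj with <-cmp (toℕ i) (toℕ j)
    ... | tri< i<j _ _ = inj₂ (adjacent-<⇒successor i j i<j pipj)
    ... | tri≈ _ i≡j _ = ⊥-elim (adjacent⇒distinct G pipj (cong p (toℕ-injective i≡j)))
    ... | tri> _ _ j<i = inj₁ (adjacent-<⇒successor j i j<i (sym G pipj))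

module _ {H G : Graph} {X : Fin (n H) → Subset (n G)} where

  open Walks G

  updateAt-⊆ : ∀ {y S} → S ⊆ X y → ∀ z → updateAt X y (const S) z ⊆ X z
  updateAt-⊆ {y} {S} S⊆Xy z with updateAt-const-view X y S z
  ... | inj₁ (refl , eq) rewrite eq = S⊆Xy
  ... | inj₂ (_    , eq) rewrite eq = λ v∈ → v∈

  ValidReplacement : Fin (n H) → Subset (n G) → Set
  ValidReplacement y S = S ⊆ X y × ConnectedNonempty G S × (∀ z → Adj H y z → Joined G S (X z))

  replacement-model : IsModel H G X → ∀ {y S} → ValidReplacement y S →
                      IsModel H G (updateAt X y (const S))
  replacement-model model {y} {S} (S⊆Xy , S-connected , S-joined) = record
    { connected = connected
    ; disjoint  = λ p q p≢q v v∈p v∈q → IsModel.disjoint model p q p≢q v (X′⊆X p v∈p) (X′⊆X q v∈q)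
    ; edges     = λ p q p≢q → mk⇔ (Equivalence.to (IsModel.edges model p q p≢q) ∘ joined-⊆ (X′⊆X p) (X′⊆X q))
                                  (adjacent⇒joined p q p≢q)
    }
    where
    X′ = updateAt X y (const S)
    X′⊆X = updateAt-⊆ S⊆Xy
    view = updateAt-const-view X y S

    connected : ∀ z → ConnectedNonempty G (X′ z)
    connected z with view z
    ... | inj₁ (refl , eq) rewrite eq = S-connected
    ... | inj₂ (_    , eq) rewrite eq = IsModel.connected model z

    adjacent⇒joined : ∀ p q → p ≢ q → Adj H p q → Joined G (X′ p) (X′ q)
    adjacent⇒joined p q p≢q pq with view p | view q
    ... | inj₁ (refl , _)  | inj₁ (refl , _)                  = ⊥-elim (p≢q refl)
    ... | inj₁ (refl , ep) | inj₂ (_    , eq) rewrite ep | eq = S-joined q pq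
    ... | inj₂ (_    , ep) | inj₁ (refl , eq) rewrite ep | eq = joined-sym (S-joined p (sym H pq))
    ... | inj₂ (_    , ep) | inj₂ (_    , eq) rewrite ep | eq =
      Equivalence.from (IsModel.edges model p q p≢q) pq

  attachment-exists : IsModel H G X → ∀ {y z} → Adj H y z → ∃ (Attachment G (X z) (X y))
  attachment-exists model {y} {z} yz =
    joined⇒attachment (Equivalence.from (IsModel.edges model y z (adjacent⇒distinct H yz)) yz)

  replacement-covers : BagMinimal H G X → ∀ {y S} → ValidReplacement y S → X y ⊆ S
  replacement-covers (model , minimal) {y} {S} valid@(S⊆Xy , _) {v} v∈Xy with v ∈? S
  ... | yes v∈S = v∈S
  ... | no  v∉S = ⊥-elim (minimal X′ (replacement-model model valid) X′⊆X smaller)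
    where
    X′ = updateAt X y (const S)
    X′⊆X = updateAt-⊆ S⊆Xy

    S⊂Xy : ∣ X′ y ∣ < ∣ X y ∣
    S⊂Xy rewrite updateAt-updates y {const S} X = p⊂q⇒∣p∣<∣q∣ (S⊆Xy , v , v∈Xy , v∉S)

    smaller : totalSize X′ < totalSize X
    smaller = foldr-+-mono-< (λ z → p⊆q⇒∣p∣≤∣q∣ (X′⊆X z)) y S⊂Xy

  chain-covers-bag : BagMinimal H G X → ∀ {y u us w} → ChainIn (X y) u us w →
                     (∀ z → Adj H y z → Joined G (fromList (u ∷ us)) (X z)) →
                     ∀ {v} → v ∈ₛ X y → v ∈ u ∷ us
  chain-covers-bag minimal {u = u} {us} c joins v∈Xy =
    ∈-fromList⁻ (u ∷ us) (replacement-covers minimal valid v∈Xy)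
    where
    valid : ValidReplacement _ (fromList (u ∷ us))
    valid = chain-⊆ c ∘ ∈-fromList⁻ (u ∷ us) , chain-connected c , joins

  leaf-bag-singleton : BagMinimal H G X → ∀ {y w} → Adj H y w → (∀ z → Adj H y z → z ≡ w) →
                       ∣ X y ∣ ≡ 1
  leaf-bag-singleton minimal {y} {w} yw leaf with attachment-exists (proj₁ minimal) yw
  ... | a , a∈Xy , c , c∈Xw , ac = trans (cong ∣_∣ (⊆-antisym Xy⊆⁅a⁆ ⁅a⁆⊆Xy)) (∣⁅x⁆∣≡1 a)
    where
    joins : ∀ z → Adj H y z → Joined G (fromList (a ∷ [])) (X z)
    joins z yz rewrite leaf z yz = a , c , ∈-fromList⁺ (a ∷ []) (here refl) , c∈Xw , ac

    Xy⊆⁅a⁆ : X y ⊆ ⁅ a ⁆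
    Xy⊆⁅a⁆ v∈Xy rewrite singleton⁻ (chain-covers-bag minimal (stop a∈Xy) joins v∈Xy) =
      x∈⁅x⁆ a

    ⁅a⁆⊆Xy : ⁅ a ⁆ ⊆ X y
    ⁅a⁆⊆Xy v∈⁅a⁆ rewrite x∈⁅y⁆⇒x≡y a v∈⁅a⁆ = a∈Xy

module _ {H G : Graph} {X : Fin (n H) → Subset (n G)} (minimal : BagMinimal H G X)
         {y a b : Fin (n H)} (neighbours : ∀ z → Adj H y z → z ≡ a ⊎ z ≡ b) where

  open Walks G

  private
    Att : Fin (n H) → Fin (n G) → Set
    Att z = Attachment G (X z) (X y)

  chain-covers : ∀ {u us w} → ChainIn (X y) u us w → Att a u → Att b w →
                 ∀ {v} → v ∈ₛ X y → v ∈ u ∷ us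
  chain-covers {u} {us} {w} c (_ , p , p∈Xa , up) (_ , q , q∈Xb , wq) =
    chain-covers-bag minimal c joins
    where
    joins : ∀ z → Adj H y z → Joined G (fromList (u ∷ us)) (X z)
    joins z yz with neighbours z yz
    ... | inj₁ refl = u , p , ∈-fromList⁺ (u ∷ us) (here refl) , p∈Xa , up
    ... | inj₂ refl = w , q , ∈-fromList⁺ (u ∷ us) (chain-last∈ c) , q∈Xb , wq

  first-attachment-unique : ∀ {x x′} → PathIn (X y) x x′ → Att a x → Att b x′ →
                            ∀ z → Att a z → z ≡ x
  first-attachment-unique {x} (path rest c uniq) ax bx′ z az with chain-covers c ax bx′ (proj₁ az)
  ... | here z≡x = z≡x
  ... | there z∈rest with ∈-∃++ z∈rest
  ...   | xs , ys , refl =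
    let suffix = proj₂ (chain-split xs c) in
    ≡-sym (unique-++-∷-meet (x ∷ xs) uniq (here refl) (chain-covers suffix az bx′ (proj₁ ax)))

  last-attachment-unique : ∀ {x x′} → PathIn (X y) x x′ → Att a x → Att b x′ →
                           ∀ z → Att b z → z ≡ x′
  last-attachment-unique {x} (path rest c uniq) ax bx′ z bz with chain-covers c ax bx′ (proj₁ bz)
  ... | here refl = ≡-sym (singleton⁻ (chain-covers (stop (proj₁ ax)) ax bz (proj₁ bx′)))
  ... | there z∈rest with ∈-∃++ z∈rest
  ...   | xs , ys , refl =
    let prefix , suffix = chain-split xs c in
    ≡-sym (unique-++-∷-meet (x ∷ xs) uniq (chain-covers prefix ax bz (proj₁ bx′)) (chain-last∈ suffix))

  path-chordless : ∀ {x x′} (P : PathIn (X y) x x′) → Att a x → Att b x′ → Chordless P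
  path-chordless P ax bx′ xs {m = m} eq ab with chain-bypass xs (chain P) eq ab
  ... | ws , c , eq′ =
    unique-bypass xs (subst Unique eq (unique P)) (subst (m ∈_) eq′ (chain-covers c ax bx′ m∈Xy))
    where
    m∈Xy : m ∈ₛ X y
    m∈Xy = chain-⊆ (chain P) (subst (m ∈_) (≡-sym eq) (∈-++⁺ʳ xs (there (here refl))))

  degree-two-bag-is-path : Adj H y a → Adj H y b →
    Σ (Fin (n G)) λ x → Σ (Fin (n G)) λ x′ →
      (Att a x × (∀ z → Att a z → z ≡ x))
      × (Att b x′ × (∀ z → Att b z → z ≡ x′))
      × InducedPathFromTo G (X y) x x′
  degree-two-bag-is-path ya yb
    with attachment-exists (proj₁ minimal) ya | attachment-exists (proj₁ minimal) yb
  ... | x , ax | x′ , bx′ =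
    x , x′ , (ax , first-attachment-unique P ax bx′) , (bx′ , last-attachment-unique P ax bx′) ,
    chordless-path⇒induced P (chain-covers (chain P) ax bx′) (path-chordless P ax bx′)
    where
    P : PathIn (X y) x x′
    P = walk⇒path (proj₂ (IsModel.connected (proj₁ minimal) y) x x′ (proj₁ ax) (proj₁ bx′))

lemma12 : (G : Graph) (X : Fin 7 → Subset (n G)) → BagMinimal ℍ₂ G X →
    (∣ X v1 ∣ ≡ 1 × ∣ X v3 ∣ ≡ 1 × ∣ X v5 ∣ ≡ 1 × ∣ X v7 ∣ ≡ 1)
    × (Σ (Fin (n G)) λ x → Σ (Fin (n G)) λ y →
        (Attachment G (X v2) (X v4) x × (∀ z → Attachment G (X v2) (X v4) z → z ≡ x))
        × (Attachment G (X v6) (X v4) y × (∀ z → Attachment G (X v6) (X v4) z → z ≡ y))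
        × InducedPathFromTo G (X v4) x y)
lemma12 G X minimal =
  ( leaf-bag-singleton minimal (inj₁ e12) (λ { _ (inj₁ e12) → refl ; _ (inj₂ ()) })
  , leaf-bag-singleton minimal (inj₂ e23) (λ { _ (inj₁ ()) ; _ (inj₂ e23) → refl })
  , leaf-bag-singleton minimal (inj₁ e56) (λ { _ (inj₁ e56) → refl ; _ (inj₂ ()) })
  , leaf-bag-singleton minimal (inj₂ e67) (λ { _ (inj₁ ()) ; _ (inj₂ e67) → refl }) )
  , degree-two-bag-is-path minimal v4-neighbours (inj₂ e24) (inj₁ e46)
  where
  v4-neighbours : ∀ z → H2Adj v4 z → z ≡ v2 ⊎ z ≡ v6
  v4-neighbours _ (inj₁ e46) = inj₂ refl
  v4-neighbours _ (inj₂ e24) = inj₁ refl
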